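{- Let $m,k$ be positive integers and $R>2^{5}\log_2(2k)$. Let $\mathcal{G}_1, \mathcal{G}_2 \subset 2^{[m]}$ be $R$-spread uniform families (each $\mathcal{G}_i$ consisting of sets of one common size) of uniformity at most $k$. Then there exist disjoint sets $G_1 \in \mathcal{G}_1$, $G_2 \in \mathcal{G}_2$.
   Context: For a family $\mathcal{G}$ of sets and a set $X$, $\mathcal{G}(X) := \{A\setminus X : A\in\mathcal{G},\ X\subset A\}$. For $r>1$, a family $\mathcal{G}\subset 2^{[m]}$ is called $r$-spread if $|\mathcal{G}(Y)| < r^{ -|Y|}|\mathcal{G}|$ for every nonempty $Y\subset [m]$.
   Formalization: The spread parameter R ranges over the rationals. -}

module Defs where

open import Data.Nat as ℕ using (ℕ; zero; suc; _≤_)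
open import Data.Integer as ℤ using (+_)
open import Data.Rational as ℚ using (ℚ; ↥_; ↧ₙ_; _/_; _*_; _<_)
open import Data.Fin.Subset using (Subset; _⊆_; _─_; ∣_∣; Nonempty)
open import Data.Fin.Subset.Properties using (_⊆?_)
open import Data.List using (List; length; map; filter)
open import Data.List.Membership.Propositional using (_∈_)
open import Data.Product using (Σ; _×_)
open import Relation.Binary.PropositionalEquality using (_≡_)

ℕ→ℚ : ℕ → ℚ
ℕ→ℚ n = (+ n) / 1

_^ℚ_ : ℚ → ℕ → ℚ
r ^ℚ zero = ℚ.1ℚ
r ^ℚ suc n = r * (r ^ℚ n)

-- A family 𝒢 ⊂ 2^[m] is a duplicate-free list of subsets of [m] = Fin m
-- (duplicate-freeness is imposed separately in the statement).
Family : ℕ → Set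
Family m = List (Subset m)

link : ∀ {m} → Family m → Subset m → Family m
link 𝒢 X = map (λ A → A ─ X) (filter (λ A → X ⊆? A) 𝒢)

-- r-spread: |𝒢(Y)| < r^{-|Y|} |𝒢| for every nonempty Y, written equivalently
-- (r > 0) as |𝒢(Y)| · r^{|Y|} < |𝒢|.
Spread : ∀ {m} → ℚ → Family m → Set
Spread {m} r 𝒢 = (Y : Subset m) → Nonempty Y →
  ℕ→ℚ (length (link 𝒢 Y)) * (r ^ℚ ∣ Y ∣) < ℕ→ℚ (length 𝒢)

UniformAtMost : ∀ {m} → ℕ → Family m → Set
UniformAtMost {m} k 𝒢 = Σ ℕ λ s → (s ≤ k) × ((A : Subset m) → A ∈ 𝒢 → ∣ A ∣ ≡ s)

-- R > 2^5 · log₂(2k), for rational R = p / q (q = denominator, p = numerator):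
-- equivalent to p ≥ 0 and (2k)^(32 q) < 2^p.
AboveLogBound : ℚ → ℕ → Set
AboveLogBound R k = Σ ℕ λ p → (↥ R ≡ + p) × ((2 ℕ.* k) ℕ.^ (32 ℕ.* ↧ₙ R) ℕ.< 2 ℕ.^ p)

-- Colour the ground set uniformly with M = 2L colours, where L = ⌊log₂ k⌋ + 1 is the number of
-- halvings taking k to 0, and use L consecutive colours a, …, a + L - 1 as a window. Starting from
-- S ∈ 𝒢, round i replaces the current member T by a member inside (points coloured a, …, a + i) ∪ T
-- that leaves the fewest points outside the coloured part, and fails if more than ⌊k/2^(i+1)⌋ are
-- left. A failure is encoded by its remnant Z ⊆ S together with the colouring in which Z gets colour
-- a + i; that colouring alone determines a set of size at most ⌊k/2^i⌋ containing Z, so R-spreadness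
-- with R > 2⁵ log₂(2k) makes at most a quarter of all pairs (S, colouring) fail, and a run without
-- failure ends at a member of 𝒢 inside the window. Averaging over colourings, some colouring puts a
-- member of 𝒢₁ inside the colours [0, L) and a member of 𝒢₂ inside [L, 2L); these are disjoint.

module Submission where

open import Defs

module FiniteSums where

  open import Data.Nat using (ℕ; zero; suc; _+_; _*_; _^_; _≤_; _<_; z≤n; _<?_)
  open import Data.Nat.Properties
  open import Data.Bool using (Bool; true; false; if_then_else_)
  open import Data.Vec using (Vec; []; _∷_)
  open import Data.List using (List; []; _∷_; length)
  open import Data.List.Relation.Unary.Any using (here; there)
  open import Data.List.Membership.Propositional using (_∈_)
  open import Data.Product using (_×_; _,_; ∃)
  open import Relation.Binary.PropositionalEquality
  open import Relation.Nullary using (Dec; yes; no; does)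
  open import Relation.Nullary.Decidable using (dec-true)
  open import Algebra.Properties.CommutativeSemigroup +-commutativeSemigroup
    using () renaming (interchange to +-interchange)

  private
    variable
      A : Set

  𝟙 : {P : Set} → Dec P → ℕ
  𝟙 d = if does d then 1 else 0

  𝟙-yes : {P : Set} (d : Dec P) → P → 𝟙 d ≡ 1
  𝟙-yes d p rewrite dec-true d p = refl

  ∑ : List A → (A → ℕ) → ℕ
  ∑ []       f = 0
  ∑ (x ∷ xs) f = f x + ∑ xs f

  syntax ∑ xs (λ x → e) = ∑[ x ∈ xs ] e

  ∑ⱽ : List A → (m : ℕ) → (Vec A m → ℕ) → ℕ
  ∑ⱽ xs zero    f = f []
  ∑ⱽ xs (suc m) f = ∑[ x ∈ xs ] ∑ⱽ xs m (λ v → f (x ∷ v))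

  bools : List Bool
  bools = false ∷ true ∷ []

  ∈-bools : ∀ b → b ∈ bools
  ∈-bools false = here refl
  ∈-bools true  = there (here refl)

  record IsSum (S : (A → ℕ) → ℕ) : Set where
    field
      sum-cong : ∀ {f g} → (∀ a → f a ≡ g a) → S f ≡ S g
      sum-mono : ∀ {f g} → (∀ a → f a ≤ g a) → S f ≤ S g
      sum-+    : ∀ f g → S (λ a → f a + g a) ≡ S f + S g
      sum-0    : S (λ _ → 0) ≡ 0

    sum-*ˡ : ∀ c f → S (λ a → c * f a) ≡ c * S f
    sum-*ˡ zero    f = sum-0
    sum-*ˡ (suc c) f = trans (sum-+ f (λ a → c * f a)) (cong (S f +_) (sum-*ˡ c f))

    sum-*ʳ : ∀ c f → S (λ a → f a * c) ≡ S f * c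
    sum-*ʳ c f = trans (sum-cong (λ a → *-comm (f a) c)) (trans (sum-*ˡ c f) (*-comm c (S f)))

  ∑-mono-∈ : (xs : List A) {f g : A → ℕ} → (∀ x → x ∈ xs → f x ≤ g x) → ∑ xs f ≤ ∑ xs g
  ∑-mono-∈ []       f≤g = z≤n
  ∑-mono-∈ (x ∷ xs) f≤g = +-mono-≤ (f≤g x (here refl)) (∑-mono-∈ xs (λ y y∈ → f≤g y (there y∈)))

  ∑-cong : (xs : List A) {f g : A → ℕ} → (∀ a → f a ≡ g a) → ∑ xs f ≡ ∑ xs g
  ∑-cong []       f≡g = refl
  ∑-cong (x ∷ xs) f≡g = cong₂ _+_ (f≡g x) (∑-cong xs f≡g)

  ∑-distrib-+ : (xs : List A) → ∀ f g → ∑[ x ∈ xs ] (f x + g x) ≡ ∑ xs f + ∑ xs g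
  ∑-distrib-+ []       f g = refl
  ∑-distrib-+ (x ∷ xs) f g =
    trans (cong (f x + g x +_) (∑-distrib-+ xs f g)) (+-interchange (f x) (g x) (∑ xs f) (∑ xs g))

  ∑-zero : (xs : List A) → ∑[ x ∈ xs ] 0 ≡ 0
  ∑-zero []       = refl
  ∑-zero (x ∷ xs) = ∑-zero xs

  ∑-isSum : (xs : List A) → IsSum (∑ xs)
  ∑-isSum xs = record
    { sum-cong = ∑-cong xs
    ; sum-mono = λ f≤g → ∑-mono-∈ xs (λ x _ → f≤g x)
    ; sum-+    = ∑-distrib-+ xs
    ; sum-0    = ∑-zero xs
    }

  ∑ⱽ-isSum : (xs : List A) (m : ℕ) → IsSum (∑ⱽ xs m)
  ∑ⱽ-isSum xs m = record
    { sum-cong = pointwise m ; sum-mono = mono m ; sum-+ = distrib m ; sum-0 = zeros m }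
    where
    pointwise : ∀ m {f g} → (∀ a → f a ≡ g a) → ∑ⱽ xs m f ≡ ∑ⱽ xs m g
    pointwise zero    f≡g = f≡g []
    pointwise (suc m) f≡g = ∑-cong xs (λ x → pointwise m (λ v → f≡g (x ∷ v)))
    mono : ∀ m {f g} → (∀ a → f a ≤ g a) → ∑ⱽ xs m f ≤ ∑ⱽ xs m g
    mono zero    f≤g = f≤g []
    mono (suc m) f≤g = ∑-mono-∈ xs (λ x _ → mono m (λ v → f≤g (x ∷ v)))
    distrib : ∀ m f g → ∑ⱽ xs m (λ v → f v + g v) ≡ ∑ⱽ xs m f + ∑ⱽ xs m g
    distrib zero    f g = refl
    distrib (suc m) f g = trans (∑-cong xs (λ x → distrib m _ _)) (∑-distrib-+ xs _ _)
    zeros : ∀ m → ∑ⱽ xs m (λ _ → 0) ≡ 0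
    zeros zero    = refl
    zeros (suc m) = trans (∑-cong xs (λ x → zeros m)) (∑-zero xs)

  module _ {B : Set} {T : (B → ℕ) → ℕ} (T-isSum : IsSum T) where
    open IsSum T-isSum

    ∑-comm : (xs : List A) (f : A → B → ℕ) →
             ∑[ x ∈ xs ] T (f x) ≡ T (λ b → ∑[ x ∈ xs ] f x b)
    ∑-comm []       f = sym sum-0
    ∑-comm (x ∷ xs) f = trans (cong (T (f x) +_) (∑-comm xs f)) (sym (sum-+ _ _))

    ∑ⱽ-comm : (xs : List A) (m : ℕ) (f : Vec A m → B → ℕ) →
              ∑ⱽ xs m (λ v → T (f v)) ≡ T (λ b → ∑ⱽ xs m (λ v → f v b))
    ∑ⱽ-comm xs zero    f = refl
    ∑ⱽ-comm xs (suc m) f =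
      trans (∑-cong xs (λ x → ∑ⱽ-comm xs m (λ v → f (x ∷ v)))) (∑-comm xs _)

  ∑-const : (xs : List A) (c : ℕ) → ∑[ x ∈ xs ] c ≡ length xs * c
  ∑-const []       c = refl
  ∑-const (x ∷ xs) c = cong (c +_) (∑-const xs c)

  ∑ⱽ-const : (xs : List A) (m c : ℕ) → ∑ⱽ xs m (λ _ → c) ≡ length xs ^ m * c
  ∑ⱽ-const xs zero    c = sym (+-identityʳ c)
  ∑ⱽ-const xs (suc m) c = begin
    ∑[ x ∈ xs ] ∑ⱽ xs m (λ _ → c)  ≡⟨ ∑-cong xs (λ _ → ∑ⱽ-const xs m c) ⟩
    ∑[ x ∈ xs ] (length xs ^ m * c) ≡⟨ ∑-const xs _ ⟩
    length xs * (length xs ^ m * c) ≡⟨ *-assoc (length xs) _ c ⟨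
    length xs ^ suc m * c ∎
    where open ≡-Reasoning

  ∈⇒≤∑ : ∀ {xs : List A} (f : A → ℕ) {x} → x ∈ xs → f x ≤ ∑ xs f
  ∈⇒≤∑ f (here refl) = m≤m+n _ _
  ∈⇒≤∑ f (there x∈)  = ≤-trans (∈⇒≤∑ f x∈) (m≤n+m _ _)

  ≤∑ⱽ : ∀ {xs : List A} → (∀ a → a ∈ xs) → ∀ {m} (f : Vec A m → ℕ) v → f v ≤ ∑ⱽ xs m f
  ≤∑ⱽ all∈ f []      = ≤-refl
  ≤∑ⱽ all∈ f (x ∷ v) = ≤-trans (≤∑ⱽ all∈ _ v) (∈⇒≤∑ _ (all∈ x))

  ∑<∑⇒∃ : (xs : List A) (f g : A → ℕ) → ∑ xs f < ∑ xs g → ∃ λ x → x ∈ xs × f x < g x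
  ∑<∑⇒∃ []       f g ()
  ∑<∑⇒∃ (x ∷ xs) f g lt with f x <? g x
  ... | yes fx<gx = x , here refl , fx<gx
  ... | no  fx≮gx with ∑<∑⇒∃ xs f g (+-cancelˡ-< _ _ _ (<-≤-trans lt (+-monoˡ-≤ _ (≮⇒≥ fx≮gx))))
  ...   | y , y∈ , fy<gy = y , there y∈ , fy<gy

  ∑ⱽ<∑ⱽ⇒∃ : (xs : List A) (m : ℕ) (f g : Vec A m → ℕ) → ∑ⱽ xs m f < ∑ⱽ xs m g → ∃ λ v → f v < g v
  ∑ⱽ<∑ⱽ⇒∃ xs zero    f g lt = [] , lt
  ∑ⱽ<∑ⱽ⇒∃ xs (suc m) f g lt with ∑<∑⇒∃ xs _ _ lt
  ... | x , _ , lt′ with ∑ⱽ<∑ⱽ⇒∃ xs m _ _ lt′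
  ...   | v , fv<gv = x ∷ v , fv<gv

module Halving where

  open FiniteSums
  open import Data.Nat using (ℕ; zero; suc; _+_; _*_; _^_; _≤_; _<_; z≤n; s≤s; ⌊_/2⌋; ⌈_/2⌉; NonZero)
  open import Data.Nat.Properties
  open import Data.Nat.Induction using (<-wellFounded)
  open import Induction.WellFounded using (Acc; acc)
  open import Data.Product using (Σ; _×_; _,_)
  open import Relation.Binary.PropositionalEquality
  open import Data.Empty using (⊥-elim)
  open import Data.Nat.Tactic.RingSolver using (solve-∀)
  open import Data.List using (downFrom)
  open import Function using (_∘_)

  ⌊_/2^_⌋ : ℕ → ℕ → ℕ
  ⌊ k /2^ zero  ⌋ = k
  ⌊ k /2^ suc i ⌋ = ⌊ ⌊ k /2^ i ⌋ /2⌋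

  ⌊k/2^[1+i]⌋≡⌊⌊k/2⌋/2^i⌋ : ∀ k i → ⌊ k /2^ suc i ⌋ ≡ ⌊ ⌊ k /2⌋ /2^ i ⌋
  ⌊k/2^[1+i]⌋≡⌊⌊k/2⌋/2^i⌋ k zero    = refl
  ⌊k/2^[1+i]⌋≡⌊⌊k/2⌋/2^i⌋ k (suc i) = cong ⌊_/2⌋ (⌊k/2^[1+i]⌋≡⌊⌊k/2⌋/2^i⌋ k i)

  2*⌊n/2⌋≤n : ∀ n → 2 * ⌊ n /2⌋ ≤ n
  2*⌊n/2⌋≤n n = begin
    2 * ⌊ n /2⌋       ≡⟨ cong (⌊ n /2⌋ +_) (+-identityʳ _) ⟩
    ⌊ n /2⌋ + ⌊ n /2⌋ ≤⟨ +-monoʳ-≤ ⌊ n /2⌋ (⌊n/2⌋≤⌈n/2⌉ n) ⟩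
    ⌊ n /2⌋ + ⌈ n /2⌉ ≡⟨ ⌊n/2⌋+⌈n/2⌉≡n n ⟩
    n                 ∎
    where open ≤-Reasoning

  n≤1+2*⌊n/2⌋ : ∀ n → n ≤ suc (2 * ⌊ n /2⌋)
  n≤1+2*⌊n/2⌋ n = begin
    n                     ≡⟨ ⌊n/2⌋+⌈n/2⌉≡n n ⟨
    ⌊ n /2⌋ + ⌈ n /2⌉     ≤⟨ +-monoʳ-≤ ⌊ n /2⌋ (⌊n/2⌋-mono (n≤1+n (suc n))) ⟩
    ⌊ n /2⌋ + suc ⌊ n /2⌋ ≡⟨ +-suc ⌊ n /2⌋ _ ⟩
    suc (⌊ n /2⌋ + ⌊ n /2⌋) ≡⟨ cong (λ x → suc (⌊ n /2⌋ + x)) (+-identityʳ _) ⟨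
    suc (2 * ⌊ n /2⌋)     ∎
    where open ≤-Reasoning

  -- L is the number of halvings that take k to 0, i.e. ⌊log₂ k⌋ + 1.
  HalvingTime : ℕ → ℕ → Set
  HalvingTime k L = ⌊ k /2^ L ⌋ ≡ 0 × (∀ i → i < L → 0 < ⌊ k /2^ i ⌋) × 2 ^ L ≤ 2 * k

  halvingTime : ∀ k → 0 < k → Σ ℕ (HalvingTime k)
  halvingTime k 0<k = go k 0<k (<-wellFounded k)
    where
    go : ∀ k → 0 < k → Acc _<_ k → Σ ℕ (HalvingTime k)
    go (suc zero)    _ _        = 1 , refl , (λ { zero _ → s≤s z≤n ; (suc i) (s≤s ()) }) , ≤-refl
    go (suc (suc k)) _ (acc rs) with go ⌊ suc (suc k) /2⌋ (s≤s z≤n) (rs (⌊n/2⌋<n (suc k)))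
    ... | L , vanishes , positive , 2^L≤2⌊k/2⌋ =
      suc L , trans (⌊k/2^[1+i]⌋≡⌊⌊k/2⌋/2^i⌋ _ L) vanishes , positive′ ,
      *-monoʳ-≤ 2 (≤-trans 2^L≤2⌊k/2⌋ (2*⌊n/2⌋≤n (suc (suc k))))
      where
      positive′ : ∀ i → i < suc L → 0 < ⌊ suc (suc k) /2^ i ⌋
      positive′ zero    _         = s≤s z≤n
      positive′ (suc i) (s≤s i<L) = subst (0 <_) (sym (⌊k/2^[1+i]⌋≡⌊⌊k/2⌋/2^i⌋ _ i)) (positive i i<L)

  HalvingTime⇒0<L : ∀ {k L} → 0 < k → HalvingTime k L → 0 < L
  HalvingTime⇒0<L {L = zero}  0<k (k≡0 , _) = ⊥-elim (<⇒≢ 0<k (sym k≡0))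
  HalvingTime⇒0<L {L = suc L} _   _         = s≤s z≤n

  ^-distribʳ-* : ∀ m n o → (m * n) ^ o ≡ m ^ o * n ^ o
  ^-distribʳ-* m n zero    = refl
  ^-distribʳ-* m n (suc o) = trans (cong (m * n *_) (^-distribʳ-* m n o)) (shuffle m n (m ^ o) (n ^ o))
    where
    shuffle : ∀ a b c d → a * b * (c * d) ≡ a * c * (b * d)
    shuffle = solve-∀

  4*4^n≤16^[1+⌊n/2⌋] : ∀ n → 4 * 4 ^ n ≤ 16 ^ suc ⌊ n /2⌋
  4*4^n≤16^[1+⌊n/2⌋] n = begin
    4 ^ suc n                ≤⟨ ^-monoʳ-≤ 4 (+-monoʳ-≤ 1 (n≤1+2*⌊n/2⌋ n)) ⟩
    4 ^ (2 + 2 * ⌊ n /2⌋)    ≡⟨ cong (4 ^_) (*-suc 2 ⌊ n /2⌋) ⟨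
    4 ^ (2 * suc ⌊ n /2⌋)    ≡⟨ ^-*-assoc 4 2 (suc ⌊ n /2⌋) ⟨
    16 ^ suc ⌊ n /2⌋         ∎
    where open ≤-Reasoning

  -- 2^κ · 4 · 2^κ = 4^(κ+1) ≤ 16^(⌊κ/2⌋+1): a factor 16 per unit of the exponent pays for the weight 4 · 2^κ.
  weighted-round : ∀ {B N P Q} κ → .{{_ : NonZero P}} → 16 * Q ≤ P →
                   B * P ^ suc ⌊ κ /2⌋ ≤ N * Q ^ suc ⌊ κ /2⌋ * 2 ^ κ → B * (4 * 2 ^ κ) ≤ N
  weighted-round {B} {N} {P} {Q} κ 16Q≤P bound = *-cancelʳ-≤ _ _ (P ^ e) {{m^n≢0 P e}} (begin
    B * (4 * 2 ^ κ) * P ^ e            ≡⟨ shuffle₁ B (P ^ e) (2 ^ κ) ⟩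
    B * P ^ e * (4 * 2 ^ κ)            ≤⟨ *-monoˡ-≤ (4 * 2 ^ κ) bound ⟩
    N * Q ^ e * 2 ^ κ * (4 * 2 ^ κ)    ≡⟨ shuffle₂ N (Q ^ e) (2 ^ κ) ⟩
    N * (Q ^ e * (4 * (2 ^ κ * 2 ^ κ))) ≡⟨ cong (λ x → N * (Q ^ e * (4 * x))) (^-distribʳ-* 2 2 κ) ⟨
    N * (Q ^ e * (4 * 4 ^ κ))          ≤⟨ *-monoʳ-≤ N (*-monoʳ-≤ (Q ^ e) (4*4^n≤16^[1+⌊n/2⌋] κ)) ⟩
    N * (Q ^ e * 16 ^ e)               ≡⟨ cong (N *_) (^-distribʳ-* Q 16 e) ⟨
    N * (Q * 16) ^ e                   ≤⟨ *-monoʳ-≤ N (^-monoˡ-≤ e (≤-trans (≤-reflexive (*-comm Q 16)) 16Q≤P)) ⟩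
    N * P ^ e                          ∎)
    where
    open ≤-Reasoning
    e : ℕ
    e = suc ⌊ κ /2⌋
    shuffle₁ : ∀ b p x → b * (4 * x) * p ≡ b * p * (4 * x)
    shuffle₁ = solve-∀
    shuffle₂ : ∀ n q x → n * q * x * (4 * x) ≡ n * (q * (4 * (x * x)))
    shuffle₂ = solve-∀

  ∑-geometric : ∀ (B X : ℕ → ℕ) T j → (∀ i → i < j → B i * X i ≤ T) →
                (∀ i → i < j → 2 * X (suc i) ≤ X i) → (∑[ i ∈ downFrom j ] B i) * X j ≤ T
  ∑-geometric B X T zero    _     _      = z≤n
  ∑-geometric B X T (suc j) Bᵢ≤T halves = *-cancelˡ-≤ 2 (begin
    2 * ((B j + S) * X (suc j)) ≡⟨ shuffle 2 (B j + S) (X (suc j)) ⟩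
    (B j + S) * (2 * X (suc j)) ≤⟨ *-monoʳ-≤ (B j + S) (halves j ≤-refl) ⟩
    (B j + S) * X j             ≡⟨ *-distribʳ-+ (X j) (B j) S ⟩
    B j * X j + S * X j         ≤⟨ +-mono-≤ (Bᵢ≤T j ≤-refl) (∑-geometric B X T j (λ i → Bᵢ≤T i ∘ below) (λ i → halves i ∘ below)) ⟩
    T + T                       ≡⟨ cong (T +_) (+-identityʳ T) ⟨
    2 * T                       ∎)
    where
    open ≤-Reasoning
    S : ℕ
    S = ∑[ i ∈ downFrom j ] B i
    below : ∀ {i} → i < j → i < suc j
    below = m≤n⇒m≤1+n
    shuffle : ∀ a b c → a * (b * c) ≡ b * (a * c)
    shuffle = solve-∀

module Subsets where

  open FiniteSums
  open import Data.Nat using (ℕ; suc; _+_; _^_; _≤_; _<_; z<s)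
  open import Data.Nat.Properties
  open import Data.Vec using ([]; _∷_)
  open import Data.Vec.Base using (here; there)
  open import Data.Fin.Subset using (Subset; _─_; ∣_∣; Nonempty; _∈_; _∉_; _⊆_; inside; outside)
  open import Data.Fin.Subset.Properties
    using (_⊆?_; _∈?_; p⊂q⇒∣p∣<∣q∣; p─q⊆p; x∈p∧x∉q⇒x∈p─q; x∈p⇒∣p-x∣<∣p∣; nonempty?; Empty-unique; ∣⊥∣≡0)
  open import Data.Product using (_,_)
  open import Data.Empty using (⊥-elim)
  open import Function using (_∘_)
  open import Relation.Binary.PropositionalEquality
  open import Relation.Nullary using (yes; no)

  private
    variable
      m : ℕ

  ∑ˢ : ∀ m → (Subset m → ℕ) → ℕ
  ∑ˢ = ∑ⱽ bools

  x∈p─q⇒x∉q : ∀ (p q : Subset m) {x} → x ∈ p ─ q → x ∉ q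
  x∈p─q⇒x∉q (inside  ∷ p) (outside ∷ q) here       ()
  x∈p─q⇒x∉q (inside  ∷ p) (outside ∷ q) (there x∈) (there x∈q) = x∈p─q⇒x∉q p q x∈ x∈q
  x∈p─q⇒x∉q (outside ∷ p) (outside ∷ q) (there x∈) (there x∈q) = x∈p─q⇒x∉q p q x∈ x∈q
  x∈p─q⇒x∉q (_       ∷ p) (inside  ∷ q) (there x∈) (there x∈q) = x∈p─q⇒x∉q p q x∈ x∈q

  ─-antitoneʳ : (p : Subset m) {q r : Subset m} → q ⊆ r → p ─ r ⊆ p ─ q
  ─-antitoneʳ p {q} {r} q⊆r x∈ = x∈p∧x∉q⇒x∈p─q (p─q⊆p p r x∈) (x∈p─q⇒x∉q p r x∈ ∘ q⊆r)

  0<∣p∣⇒Nonempty : (p : Subset m) → 0 < ∣ p ∣ → Nonempty p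
  0<∣p∣⇒Nonempty {m} p 0<∣p∣ with nonempty? p
  ... | yes ne = ne
  ... | no ¬ne = ⊥-elim (<⇒≢ 0<∣p∣ (sym (trans (cong ∣_∣ (Empty-unique ¬ne)) (∣⊥∣≡0 m))))

  ∣p─q∣≤0⇒p⊆q : {p q : Subset m} → ∣ p ─ q ∣ ≤ 0 → p ⊆ q
  ∣p─q∣≤0⇒p⊆q {p = p} {q} ∣p─q∣≤0 {x} x∈p with x ∈? q
  ... | yes x∈q = x∈q
  ... | no  x∉q = ⊥-elim (<⇒≱ (<-≤-trans z<s (x∈p⇒∣p-x∣<∣p∣ (x∈p∧x∉q⇒x∈p─q x∈p x∉q))) ∣p─q∣≤0)

  ⊆∧∣∣≤⇒⊇ : {p q : Subset m} → p ⊆ q → ∣ q ∣ ≤ ∣ p ∣ → q ⊆ p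
  ⊆∧∣∣≤⇒⊇ {p = p} p⊆q ∣q∣≤∣p∣ {x} x∈q with x ∈? p
  ... | yes x∈p = x∈p
  ... | no  x∉p = ⊥-elim (<⇒≱ (p⊂q⇒∣p∣<∣q∣ (p⊆q , x , x∈q , x∉p)) ∣q∣≤∣p∣)

  ∑ˢ-subsets : (F : Subset m) → ∑ˢ m (λ Z → 𝟙 (Z ⊆? F)) ≤ 2 ^ ∣ F ∣
  ∑ˢ-subsets []            = ≤-refl
  ∑ˢ-subsets {suc m} (outside ∷ F) = subst (_≤ 2 ^ ∣ F ∣) (sym only-outside) (∑ˢ-subsets F)
    where
    only-outside : ∑ˢ m (λ Z → 𝟙 (Z ⊆? F)) + (∑ˢ m (λ _ → 0) + 0) ≡ ∑ˢ m (λ Z → 𝟙 (Z ⊆? F))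
    only-outside = trans (cong (∑ˢ m (λ Z → 𝟙 (Z ⊆? F)) +_) (trans (+-identityʳ _) (IsSum.sum-0 (∑ⱽ-isSum bools m))))
                         (+-identityʳ _)
  ∑ˢ-subsets (inside  ∷ F) = +-mono-≤ (∑ˢ-subsets F) (+-monoˡ-≤ 0 (∑ˢ-subsets F))

module Colourings where

  open FiniteSums
  open import Data.Nat using (ℕ; zero; suc; _*_; _^_; _≤_; _<_; _≤?_; _<?_)
  open import Data.Nat.Properties
  open import Data.Bool using (true; if_then_else_)
  open import Data.Fin using (Fin; zero; suc; toℕ)
  open import Data.Vec using (Vec; []; _∷_; lookup; map; zipWith)
  open import Data.Vec.Base using (here; there)
  open import Data.Vec.Properties using (lookup-map; []=⇒lookup; lookup⇒[]=)
  open import Data.Fin.Subset using (Subset; _∩_; ∣_∣; Empty; _∈_; _∉_; _⊆_; inside; outside)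
  open import Data.Fin.Subset.Properties using (x∈p∩q⁻)
  open import Data.List using (List; length)
  import Data.List.Membership.Propositional as List
  open import Data.Product using (_×_; _,_; proj₁; proj₂)
  open import Data.Empty using (⊥-elim)
  open import Function using (_∘_; _⇔_; mk⇔)
  open import Relation.Binary.PropositionalEquality
  open import Relation.Nullary using (Dec; yes; does)
  open import Relation.Nullary.Decidable using (dec-true; _×-dec_)
  open import Relation.Unary using (Decidable)

  private
    variable
      m : ℕ
      A : Set

  InWindow : ∀ {M} → ℕ → ℕ → Fin M → Set
  InWindow lo hi c = lo ≤ toℕ c × toℕ c < hi

  inWindow? : ∀ {M} lo hi → Decidable (InWindow {M} lo hi)
  inWindow? lo hi c = lo ≤? toℕ c ×-dec toℕ c <? hi

  opaque
    window : ∀ {M} → ℕ → ℕ → Vec (Fin M) m → Subset m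
    window lo hi ℓ = map (λ c → does (inWindow? lo hi c)) ℓ

    ∈-window⁺ : ∀ {M} lo hi (ℓ : Vec (Fin M) m) {x} → InWindow lo hi (lookup ℓ x) → x ∈ window lo hi ℓ
    ∈-window⁺ lo hi ℓ {x} in-window =
      lookup⇒[]= x _ (trans (lookup-map x _ ℓ) (dec-true (inWindow? lo hi _) in-window))

    ∈-window⁻ : ∀ {M} lo hi (ℓ : Vec (Fin M) m) {x} → x ∈ window lo hi ℓ → InWindow lo hi (lookup ℓ x)
    ∈-window⁻ lo hi ℓ {x} x∈ = does⇒ (inWindow? lo hi (lookup ℓ x)) (trans (sym (lookup-map x _ ℓ)) ([]=⇒lookup x∈))
      where
      does⇒ : ∀ {P : Set} (P? : Dec P) → does P? ≡ true → P
      does⇒ (yes p) _ = p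

  ⊆-windows-disjoint : ∀ {M} lo mid hi (ℓ : Vec (Fin M) m) {T₁ T₂ : Subset m} →
                       T₁ ⊆ window lo mid ℓ → T₂ ⊆ window mid hi ℓ → Empty (T₁ ∩ T₂)
  ⊆-windows-disjoint lo mid hi ℓ {T₁} {T₂} T₁⊆ T₂⊆ (x , x∈T₁∩T₂) with x∈p∩q⁻ T₁ T₂ x∈T₁∩T₂
  ... | x∈T₁ , x∈T₂ =
    <⇒≱ (proj₂ (∈-window⁻ lo mid ℓ (T₁⊆ x∈T₁))) (proj₁ (∈-window⁻ mid hi ℓ (T₂⊆ x∈T₂)))

  recolour : Subset m → A → Vec A m → Vec A m
  recolour Z c ℓ = zipWith (λ b y → if b then c else y) Z ℓ

  lookup-recolour-∈ : ∀ {Z : Subset m} {x} (c : A) ℓ → x ∈ Z → lookup (recolour Z c ℓ) x ≡ c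
  lookup-recolour-∈ c (y ∷ ℓ) here        = refl
  lookup-recolour-∈ c (y ∷ ℓ) (there x∈Z) = lookup-recolour-∈ c ℓ x∈Z

  lookup-recolour-∉ : ∀ (Z : Subset m) {x} (c : A) ℓ → x ∉ Z → lookup (recolour Z c ℓ) x ≡ lookup ℓ x
  lookup-recolour-∉ (inside  ∷ Z) {zero}  c (y ∷ ℓ) x∉Z = ⊥-elim (x∉Z here)
  lookup-recolour-∉ (outside ∷ Z) {zero}  c (y ∷ ℓ) x∉Z = refl
  lookup-recolour-∉ (_       ∷ Z) {suc x} c (y ∷ ℓ) x∉Z = lookup-recolour-∉ Z c ℓ (x∉Z ∘ there)

  ∈-window-recolour-∉ : ∀ {M} lo hi {Z : Subset m} (c : Fin M) ℓ {x} → x ∉ Z →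
                        x ∈ window lo hi (recolour Z c ℓ) ⇔ x ∈ window lo hi ℓ
  ∈-window-recolour-∉ lo hi {Z} c ℓ {x} x∉Z = mk⇔
    (λ x∈ → ∈-window⁺ lo hi ℓ (subst (InWindow lo hi) same (∈-window⁻ lo hi _ x∈)))
    (λ x∈ → ∈-window⁺ lo hi _ (subst (InWindow lo hi) (sym same) (∈-window⁻ lo hi ℓ x∈)))
    where
    same : lookup (recolour Z c ℓ) x ≡ lookup ℓ x
    same = lookup-recolour-∉ Z c ℓ x∉Z

  ∈-window-recolour-∈ : ∀ {M} lo hi {Z : Subset m} (c : Fin M) ℓ {x} → x ∈ Z →
                        x ∈ window lo hi (recolour Z c ℓ) ⇔ InWindow lo hi c
  ∈-window-recolour-∈ lo hi c ℓ x∈Z = mk⇔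
    (λ x∈ → subst (InWindow lo hi) (lookup-recolour-∈ c ℓ x∈Z) (∈-window⁻ lo hi _ x∈))
    (λ c∈ → ∈-window⁺ lo hi _ (subst (InWindow lo hi) (sym (lookup-recolour-∈ c ℓ x∈Z)) c∈))

  -- ℓ ↦ recolour Z c ℓ is at most (length xs ^ ∣ Z ∣)-to-one.
  ∑ⱽ-recolour : ∀ {xs : List A} {c} → c List.∈ xs → ∀ m (Z : Subset m) (f : Vec A m → ℕ) →
                ∑ⱽ xs m (f ∘ recolour Z c) ≤ length xs ^ ∣ Z ∣ * ∑ⱽ xs m f
  ∑ⱽ-recolour c∈xs zero    []            f = ≤-reflexive (sym (+-identityʳ _))
  ∑ⱽ-recolour {xs = xs} c∈xs (suc m) (outside ∷ Z) f = begin
    ∑[ x ∈ xs ] ∑ⱽ xs m (λ v → f (x ∷ recolour Z _ v))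
      ≤⟨ ∑-mono-∈ xs (λ x _ → ∑ⱽ-recolour c∈xs m Z _) ⟩
    ∑[ x ∈ xs ] (n ^ ∣ Z ∣ * ∑ⱽ xs m (λ v → f (x ∷ v)))
      ≡⟨ IsSum.sum-*ˡ (∑-isSum xs) (n ^ ∣ Z ∣) _ ⟩
    n ^ ∣ Z ∣ * ∑ⱽ xs (suc m) f ∎
    where
    open ≤-Reasoning
    n : ℕ
    n = length xs
  ∑ⱽ-recolour {xs = xs} {c} c∈xs (suc m) (inside ∷ Z) f = begin
    ∑[ x ∈ xs ] ∑ⱽ xs m (λ v → f (c ∷ recolour Z c v))
      ≡⟨ ∑-const xs _ ⟩
    n * ∑ⱽ xs m (λ v → f (c ∷ recolour Z c v))
      ≤⟨ *-monoʳ-≤ n (∑ⱽ-recolour c∈xs m Z _) ⟩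
    n * (n ^ ∣ Z ∣ * ∑ⱽ xs m (λ v → f (c ∷ v)))
      ≤⟨ *-monoʳ-≤ n (*-monoʳ-≤ (n ^ ∣ Z ∣) (∈⇒≤∑ (λ x → ∑ⱽ xs m (λ v → f (x ∷ v))) c∈xs)) ⟩
    n * (n ^ ∣ Z ∣ * ∑ⱽ xs (suc m) f)
      ≡⟨ *-assoc n _ _ ⟨
    n ^ suc ∣ Z ∣ * ∑ⱽ xs (suc m) f ∎
    where
    open ≤-Reasoning
    n : ℕ
    n = length xs

module Fractions where

  open import Data.Nat as ℕ using (ℕ; zero; suc)
  import Data.Nat.Properties as ℕ
  open import Data.Integer as ℤ using (+_)
  import Data.Integer.Properties as ℤ
  open import Data.Rational as ℚ using (ℚ; ↥_; ↧ₙ_; toℚᵘ; mkℚ)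
  import Data.Rational.Properties as ℚ
  open import Data.Rational.Unnormalised as ℚᵘ using (ℚᵘ; mkℚᵘ)
  import Data.Rational.Unnormalised.Properties as ℚᵘ
  open import Data.Product using (_×_; _,_)
  open import Relation.Binary.PropositionalEquality

  infixr 8 _^ᵘ_
  _^ᵘ_ : ℚᵘ → ℕ → ℚᵘ
  r ^ᵘ zero  = ℚᵘ.1ℚᵘ
  r ^ᵘ suc t = r ℚᵘ.* (r ^ᵘ t)

  toℚᵘ-^ : ∀ r t → toℚᵘ (r ^ℚ t) ℚᵘ.≃ toℚᵘ r ^ᵘ t
  toℚᵘ-^ r zero    = ℚᵘ.≃-refl
  toℚᵘ-^ r (suc t) = ℚᵘ.≃-trans (ℚ.toℚᵘ-homo-* r (r ^ℚ t)) (ℚᵘ.*-congˡ {toℚᵘ r} (toℚᵘ-^ r t))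

  infix 4 _≐_/_
  _≐_/_ : ℚᵘ → ℕ → ℕ → Set
  x ≐ n / d = ℚᵘ.↥ x ≡ + n × ℚᵘ.↧ₙ x ≡ d

  ≐-* : ∀ {x y n d n′ d′} → x ≐ n / d → y ≐ n′ / d′ → x ℚᵘ.* y ≐ n ℕ.* n′ / (d ℕ.* d′)
  ≐-* {mkℚᵘ _ _} {mkℚᵘ _ _} {n} {n′ = n′} (refl , refl) (refl , refl) = sym (ℤ.pos-* n n′) , refl

  ≐-^ : ∀ {r n d} → r ≐ n / d → ∀ t → r ^ᵘ t ≐ n ℕ.^ t / (d ℕ.^ t)
  ≐-^ r≐ zero    = refl , refl
  ≐-^ {r} r≐ (suc t) = ≐-* {r} {r ^ᵘ t} r≐ (≐-^ r≐ t)

  ≐-<⇒< : ∀ {x y n d n′ d′} → x ≐ n / d → y ≐ n′ / d′ → x ℚᵘ.< y → n ℕ.* d′ ℕ.< n′ ℕ.* d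
  ≐-<⇒< {mkℚᵘ _ _} {mkℚᵘ _ _} {n} {d} {n′} {d′} (refl , refl) (refl , refl) x<y =
    ℤ.drop‿+<+ (subst₂ ℤ._<_ (sym (ℤ.pos-* n d′)) (sym (ℤ.pos-* n′ d)) (ℚᵘ.drop-*<* x<y))

  -- Computed in ℚᵘ, where products multiply numerators and denominators without gcd normalisation.
  ℚ-spread⇒ℕ : ∀ (R : ℚ) {p} → ↥ R ≡ + p → ∀ c N t →
               ℕ→ℚ c ℚ.* (R ^ℚ t) ℚ.< ℕ→ℚ N → c ℕ.* p ℕ.^ t ℕ.< N ℕ.* ↧ₙ R ℕ.^ t
  ℚ-spread⇒ℕ R@(mkℚ _ _ _) refl c N t lt =
    subst₂ ℕ._<_ (ℕ.*-identityʳ _) (cong (N ℕ.*_) (ℕ.*-identityˡ _))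
      (≐-<⇒< (≐-* {mkℚᵘ (+ c) 0} {toℚᵘ R ^ᵘ t} (refl , refl) (≐-^ {toℚᵘ R} (refl , refl) t))
              (refl , refl) lt′)
    where
    lt′ : mkℚᵘ (+ c) 0 ℚᵘ.* (toℚᵘ R ^ᵘ t) ℚᵘ.< mkℚᵘ (+ N) 0
    lt′ = ℚᵘ.<-respʳ-≃ (ℚ.toℚᵘ-fromℚᵘ (mkℚᵘ (+ N) 0))
            (ℚᵘ.<-respˡ-≃ (ℚᵘ.≃-trans (ℚ.toℚᵘ-homo-* (ℕ→ℚ c) (R ^ℚ t))
                                        (ℚᵘ.*-cong (ℚ.toℚᵘ-fromℚᵘ (mkℚᵘ (+ c) 0)) (toℚᵘ-^ R t)))
                          (ℚ.toℚᵘ-mono-< lt))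

module HalvingProcess where

  open FiniteSums
  open Halving
  open Subsets
  open Colourings
  open import Data.Nat using (ℕ; zero; suc; _+_; _*_; _^_; _≤_; _<_; z≤n; s≤s; _≤?_; ⌊_/2⌋; NonZero; >-nonZero)
  open import Data.Nat.Properties
  open import Data.Bool using (if_then_else_)
  open import Data.Fin using (Fin; toℕ; fromℕ<)
  open import Data.Fin.Properties using (toℕ-fromℕ<)
  open import Data.Vec using (Vec)
  open import Data.Fin.Subset using (Subset; _─_; _∪_; ∣_∣; _∈_; _∉_; _⊆_; ⊥)
  open import Data.Fin.Subset.Properties
    using (_⊆?_; _∈?_; p⊆q⇒∣p∣≤∣q∣; p─q⊆p; x∈p∧x∉q⇒x∈p─q; x∈p∪q⁻; x∈p∪q⁺; q⊆p∪q; ∣⊥∣≡0; ∣p─q∣≤∣p∣)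
  open import Data.List using (List; []; _∷_; filter; downFrom; length; allFin)
  open import Data.List.Properties using (length-tabulate)
  open import Data.Nat.Tactic.RingSolver using (solve-∀)
  open import Function using (id)
  open import Data.List.Membership.Propositional using () renaming (_∈_ to _∈ₗ_)
  open import Data.List.Membership.Propositional.Properties using (∈-filter⁺; ∈-filter⁻; ∈-allFin)
  open import Data.List.Relation.Unary.All as All using (All; []; _∷_; tabulate)
  open import Data.List.Relation.Unary.Any using (here; there)
  open import Data.List.Extrema.Nat using (argmin; argmin-all; f[argmin]≤f[xs])
  open import Data.Maybe using (Maybe; just; nothing; maybe′; _>>=_)
  open import Data.Product using (Σ; _×_; _,_; proj₁; proj₂)
  open import Data.Sum using (_⊎_; inj₁; inj₂)
  open import Data.Empty using (⊥-elim)
  open import Function using (_∘_; _⇔_; mk⇔; Equivalence; case_of_)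
  open import Relation.Binary.PropositionalEquality
  open import Relation.Nullary using (Dec; yes; no; does; ¬?)
  open import Relation.Nullary.Decidable using (_×-dec_; dec-true; dec-false)
  open import Relation.Unary using (Decidable)

  open Equivalence using (to; from)

  firstOr : {A : Set} → A → List A → A
  firstOr d []      = d
  firstOr d (x ∷ _) = x

  firstOr-All : {A : Set} {P : A → Set} {d : A} {xs : List A} → P d → All P xs → P (firstOr d xs)
  firstOr-All {xs = []}    pd []      = pd
  firstOr-All {xs = _ ∷ _} pd (px ∷ _) = px

  firstOr-∈ : {A : Set} {d x : A} {xs : List A} → x ∈ₗ xs → firstOr d xs ∈ₗ xs
  firstOr-∈ (here _)  = here refl
  firstOr-∈ (there _) = here refl

  degree : ∀ {m} → List (Subset m) → Subset m → ℕ
  degree 𝒢 Z = ∑[ S ∈ 𝒢 ] 𝟙 (Z ⊆? S)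

  module Process {m : ℕ} (M : ℕ) (𝒢 : List (Subset m)) (k a : ℕ) (small : ∀ S → S ∈ₗ 𝒢 → ∣ S ∣ ≤ k) where

    Colouring : Set
    Colouring = Vec (Fin M) m

    κ : ℕ → ℕ
    κ i = ⌊ k /2^ i ⌋

    W : ℕ → Colouring → Subset m
    W i = window a (a + i)

    W-mono : ∀ i ℓ {x} → x ∈ W i ℓ → x ∈ W (suc i) ℓ
    W-mono i ℓ x∈ with ∈-window⁻ a (a + i) ℓ x∈
    ... | a≤ , <a+i = ∈-window⁺ a (a + suc i) ℓ (a≤ , ≤-trans <a+i (+-monoʳ-≤ a (n≤1+n i)))

    Candidate : ℕ → Colouring → Subset m → Subset m → Set
    Candidate i ℓ T U = ∣ U ─ W i ℓ ∣ ≤ κ i × U ⊆ W (suc i) ℓ ∪ T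

    candidate? : ∀ i ℓ T → Decidable (Candidate i ℓ T)
    candidate? i ℓ T U = ∣ U ─ W i ℓ ∣ ≤? κ i ×-dec U ⊆? W (suc i) ℓ ∪ T

    opaque
      step : ℕ → Colouring → Subset m → Subset m
      step i ℓ T = argmin (λ U → ∣ U ─ W (suc i) ℓ ∣) T (filter (candidate? i ℓ T) 𝒢)

    remnant : ℕ → Colouring → Subset m → Subset m
    remnant i ℓ T = step i ℓ T ─ W (suc i) ℓ

    Succeeds : ℕ → Colouring → Subset m → Set
    Succeeds i ℓ T = ∣ remnant i ℓ T ∣ ≤ κ (suc i)

    succeeds? : ∀ i ℓ T → Dec (Succeeds i ℓ T)
    succeeds? i ℓ T = ∣ remnant i ℓ T ∣ ≤? κ (suc i)

    advance : ℕ → Colouring → Subset m → Maybe (Subset m)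
    advance i ℓ T = if does (succeeds? i ℓ T) then just (step i ℓ T) else nothing

    run : ℕ → Colouring → Subset m → Maybe (Subset m)
    run zero    ℓ S = just S
    run (suc i) ℓ S = run i ℓ S >>= advance i ℓ

    failsAt : ℕ → Colouring → Subset m → ℕ
    failsAt i ℓ S = maybe′ (λ T → 𝟙 (¬? (succeeds? i ℓ T))) 0 (run i ℓ S)

    failed : ℕ → Colouring → Subset m → ℕ
    failed j ℓ S = maybe′ (λ _ → 0) 1 (run j ℓ S)

    failed≤∑failsAt : ∀ j ℓ S → failed j ℓ S ≤ ∑[ i ∈ downFrom j ] failsAt i ℓ S
    failed≤∑failsAt zero    ℓ S = z≤n
    failed≤∑failsAt (suc j) ℓ S with run j ℓ S | failed≤∑failsAt j ℓ S
    ... | nothing | ih = ≤-trans ih (m≤n+m _ _)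
    ... | just T  | _ with succeeds? j ℓ T
    ...   | yes s  rewrite dec-true  (succeeds? j ℓ T) s  = z≤n
    ...   | no  ¬s rewrite dec-false (succeeds? j ℓ T) ¬s = m≤m+n 1 _

    Invariant : ℕ → Colouring → Subset m → Subset m → Set
    Invariant i ℓ S T = T ∈ₗ 𝒢 × ∣ T ─ W i ℓ ∣ ≤ κ i × T ─ W i ℓ ⊆ S

    opaque
      unfolding step

      step-candidate : ∀ {i ℓ S T} → Invariant i ℓ S T → step i ℓ T ∈ₗ 𝒢 × Candidate i ℓ T (step i ℓ T)
      step-candidate {i} {ℓ} {T = T} (T∈𝒢 , ∣T─W∣≤κ , _) =
        argmin-all (λ U → ∣ U ─ W (suc i) ℓ ∣) (T∈𝒢 , ∣T─W∣≤κ , λ {x} → q⊆p∪q (W (suc i) ℓ) T {x})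
                   (tabulate (∈-filter⁻ (candidate? i ℓ T)))

      step-minimal : ∀ i ℓ T {U} → U ∈ₗ 𝒢 → Candidate i ℓ T U → ∣ remnant i ℓ T ∣ ≤ ∣ U ─ W (suc i) ℓ ∣
      step-minimal i ℓ T U∈𝒢 cand =
        All.lookup (f[argmin]≤f[xs] {f = λ U → ∣ U ─ W (suc i) ℓ ∣} T _)
                   (∈-filter⁺ (candidate? i ℓ T) U∈𝒢 cand)

    remnant⊆ : ∀ {i ℓ S T} → Invariant i ℓ S T → remnant i ℓ T ⊆ T
    remnant⊆ {i} {ℓ} {T = T} inv x∈Z with x∈p∪q⁻ _ T (proj₂ (proj₂ (step-candidate inv)) (p─q⊆p _ _ x∈Z))
    ... | inj₁ x∈W = ⊥-elim (x∈p─q⇒x∉q _ _ x∈Z x∈W)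
    ... | inj₂ x∈T = x∈T

    remnant⊆S : ∀ {i ℓ S T} → Invariant i ℓ S T → remnant i ℓ T ⊆ S
    remnant⊆S {i} {ℓ} inv x∈Z =
      proj₂ (proj₂ inv) (x∈p∧x∉q⇒x∈p─q (remnant⊆ inv x∈Z) (x∈p─q⇒x∉q _ _ x∈Z ∘ W-mono i ℓ))

    run-invariant : ∀ i ℓ S → S ∈ₗ 𝒢 → ∀ {T} → run i ℓ S ≡ just T → Invariant i ℓ S T
    run-invariant zero    ℓ S S∈𝒢 refl = S∈𝒢 , ≤-trans (∣p─q∣≤∣p∣ S _) (small S S∈𝒢) , p─q⊆p S _
    run-invariant (suc i) ℓ S S∈𝒢 {T} ran with run i ℓ S in ran-i
    ... | nothing = case ran of λ ()
    ... | just T₀ with succeeds? i ℓ T₀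
    ...   | no ¬s rewrite dec-false (succeeds? i ℓ T₀) ¬s = case ran of λ ()
    ...   | yes s rewrite dec-true  (succeeds? i ℓ T₀) s with ran
    ...     | refl = proj₁ (step-candidate inv) , s , remnant⊆S inv
      where
      inv : Invariant i ℓ S T₀
      inv = run-invariant i ℓ S S∈𝒢 ran-i

    Fits : ℕ → Colouring → Subset m → Set
    Fits i ℓ U = ∣ U ─ W i ℓ ∣ ≤ κ i × U ⊆ W (suc i) ℓ

    fits? : ∀ i ℓ → Decidable (Fits i ℓ)
    fits? i ℓ U = ∣ U ─ W i ℓ ∣ ≤? κ i ×-dec U ⊆? W (suc i) ℓ

    -- Depends on ℓ alone, yet contains the remnant of every failing round
    -- once the remnant is recoloured a + i (`remnant⊆canonical`).
    canonical : ℕ → Colouring → Subset m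
    canonical i ℓ = firstOr ⊥ (filter (fits? i ℓ) 𝒢) ─ W i ℓ

    ∣canonical∣≤κ : ∀ i ℓ → ∣ canonical i ℓ ∣ ≤ κ i
    ∣canonical∣≤κ i ℓ = firstOr-All {P = λ U → ∣ U ─ W i ℓ ∣ ≤ κ i}
      (≤-trans (∣p─q∣≤∣p∣ ⊥ (W i ℓ)) (subst (_≤ κ i) (sym (∣⊥∣≡0 m)) z≤n))
      (tabulate (λ U∈ → proj₁ (proj₂ (∈-filter⁻ (fits? i ℓ) {xs = 𝒢} U∈))))

    module Recolouring {i ℓ S T} (inv : Invariant i ℓ S T) (c : Fin M) (c≡a+i : toℕ c ≡ a + i) where

      Z : Subset m
      Z = remnant i ℓ T

      ℓ′ : Colouring
      ℓ′ = recolour Z c ℓ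

      Z∌W : ∀ {x} → x ∈ Z → x ∉ W (suc i) ℓ
      Z∌W = x∈p─q⇒x∉q _ _

      W-unchanged : ∀ {x} → x ∈ W i ℓ′ ⇔ x ∈ W i ℓ
      W-unchanged {x} with x ∈? Z
      ... | no  x∉Z = ∈-window-recolour-∉ a (a + i) c ℓ x∉Z
      ... | yes x∈Z =
        mk⇔ (λ x∈W → ⊥-elim (<-irrefl c≡a+i (proj₂ (to (∈-window-recolour-∈ a (a + i) c ℓ x∈Z) x∈W))))
            (λ x∈W → ⊥-elim (Z∌W x∈Z (W-mono i ℓ x∈W)))

      W-grown⁻ : ∀ {x} → x ∈ W (suc i) ℓ′ → x ∈ W (suc i) ℓ ⊎ x ∈ Z
      W-grown⁻ {x} x∈W with x ∈? Z
      ... | yes x∈Z = inj₂ x∈Z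
      ... | no  x∉Z = inj₁ (to (∈-window-recolour-∉ a (a + suc i) c ℓ x∉Z) x∈W)

      W-grown⁺ : ∀ {x} → x ∈ W (suc i) ℓ ⊎ x ∈ Z → x ∈ W (suc i) ℓ′
      W-grown⁺ {x} (inj₂ x∈Z) = from (∈-window-recolour-∈ a (a + suc i) c ℓ x∈Z)
        (subst (a ≤_) (sym c≡a+i) (m≤m+n a i) , subst (_< a + suc i) (sym c≡a+i) (+-monoʳ-< a (n<1+n i)))
      W-grown⁺ {x} (inj₁ x∈W) with x ∈? Z
      ... | yes x∈Z = ⊥-elim (Z∌W x∈Z x∈W)
      ... | no  x∉Z = from (∈-window-recolour-∉ a (a + suc i) c ℓ x∉Z) x∈W

      step⊆W′ : step i ℓ T ⊆ W (suc i) ℓ′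
      step⊆W′ {x} x∈ with x ∈? W (suc i) ℓ
      ... | yes x∈W = W-grown⁺ (inj₁ x∈W)
      ... | no  x∉W = W-grown⁺ (inj₂ (x∈p∧x∉q⇒x∈p─q x∈ x∉W))

      step-fits : Fits i ℓ′ (step i ℓ T)
      step-fits =
        ≤-trans (p⊆q⇒∣p∣≤∣q∣ (─-antitoneʳ (step i ℓ T) (from W-unchanged))) (proj₁ (proj₂ (step-candidate inv))) ,
        step⊆W′

      D : Subset m
      D = firstOr ⊥ (filter (fits? i ℓ′) 𝒢)

      D∈𝒢×fits : D ∈ₗ 𝒢 × Fits i ℓ′ D
      D∈𝒢×fits =
        ∈-filter⁻ (fits? i ℓ′) (firstOr-∈ (∈-filter⁺ (fits? i ℓ′) (proj₁ (step-candidate inv)) step-fits))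

      D⊆W′ : D ⊆ W (suc i) ℓ′
      D⊆W′ = proj₂ (proj₂ D∈𝒢×fits)

      D-candidate : Candidate i ℓ T D
      D-candidate = ≤-trans (p⊆q⇒∣p∣≤∣q∣ (─-antitoneʳ D (to W-unchanged))) (proj₁ (proj₂ D∈𝒢×fits)) , D⊆
        where
        D⊆ : D ⊆ W (suc i) ℓ ∪ T
        D⊆ x∈D with W-grown⁻ (D⊆W′ x∈D)
        ... | inj₁ x∈W = x∈p∪q⁺ (inj₁ x∈W)
        ... | inj₂ x∈Z = x∈p∪q⁺ (inj₂ (remnant⊆ inv x∈Z))

      D-remnant⊆Z : D ─ W (suc i) ℓ ⊆ Z
      D-remnant⊆Z x∈ with W-grown⁻ (D⊆W′ (p─q⊆p D _ x∈))
      ... | inj₁ x∈W = ⊥-elim (x∈p─q⇒x∉q D _ x∈ x∈W)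
      ... | inj₂ x∈Z = x∈Z

      -- By minimality of the step, D leaves no less outside W (suc i) ℓ than the step does,
      -- so its remnant is all of Z.
      remnant⊆canonical : Z ⊆ canonical i ℓ′
      remnant⊆canonical x∈Z = x∈p∧x∉q⇒x∈p─q (p─q⊆p D _ (Z⊆ x∈Z)) (Z∌W x∈Z ∘ W-mono i ℓ ∘ to W-unchanged)
        where
        Z⊆ : Z ⊆ D ─ W (suc i) ℓ
        Z⊆ = ⊆∧∣∣≤⇒⊇ D-remnant⊆Z (step-minimal i ℓ T (proj₁ D∈𝒢×fits) D-candidate)

    -- (Z, recolour Z c ℓ) encodes a failure of round i at (ℓ, S) with remnant Z.
    encodes : ℕ → Fin M → Colouring → Subset m → Subset m → ℕ
    encodes i c ℓ S Z = 𝟙 (Z ⊆? S) * (𝟙 (suc (κ (suc i)) ≤? ∣ Z ∣) * 𝟙 (Z ⊆? canonical i (recolour Z c ℓ)))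

    failsAt≤∑encodes : ∀ i ℓ S → S ∈ₗ 𝒢 → (c : Fin M) → toℕ c ≡ a + i → failsAt i ℓ S ≤ ∑ˢ m (encodes i c ℓ S)
    failsAt≤∑encodes i ℓ S S∈𝒢 c c≡a+i with run i ℓ S in ran
    ... | nothing = z≤n
    ... | just T with succeeds? i ℓ T
    ...   | yes s  rewrite dec-true  (succeeds? i ℓ T) s  = z≤n
    ...   | no  ¬s rewrite dec-false (succeeds? i ℓ T) ¬s =
      ≤-trans (≤-reflexive (sym encoded)) (≤∑ⱽ ∈-bools (encodes i c ℓ S) Z)
      where
      inv : Invariant i ℓ S T
      inv = run-invariant i ℓ S S∈𝒢 ran
      open Recolouring inv c c≡a+i
      encoded : encodes i c ℓ S Z ≡ 1
      encoded = cong₂ _*_ (𝟙-yes (Z ⊆? S) (remnant⊆S inv))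
                          (cong₂ _*_ (𝟙-yes (_ ≤? ∣ Z ∣) (≰⇒> ¬s)) (𝟙-yes (Z ⊆? _) remnant⊆canonical))

    ∑ᶜ : (Colouring → ℕ) → ℕ
    ∑ᶜ = ∑ⱽ (allFin M) m

    ∑ᶜ-mono : {f g : Colouring → ℕ} → (∀ ℓ → f ℓ ≤ g ℓ) → ∑ᶜ f ≤ ∑ᶜ g
    ∑ᶜ-mono = IsSum.sum-mono (∑ⱽ-isSum (allFin M) m)

    ∑ᶜ-recolour : ∀ Z c (f : Colouring → ℕ) → ∑ᶜ (f ∘ recolour Z c) ≤ M ^ ∣ Z ∣ * ∑ᶜ f
    ∑ᶜ-recolour Z c f = subst (λ n → ∑ᶜ (f ∘ recolour Z c) ≤ n ^ ∣ Z ∣ * ∑ᶜ f) (length-tabulate id)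
                              (∑ⱽ-recolour (∈-allFin c) m Z f)

    failures : ℕ → ℕ
    failures i = ∑[ S ∈ 𝒢 ] ∑ᶜ (λ ℓ → failsAt i ℓ S)

    module Counting (P Q : ℕ)
      (spread : ∀ e Z → 0 < e → e ≤ ∣ Z ∣ → degree 𝒢 Z * M ^ ∣ Z ∣ * P ^ e ≤ length 𝒢 * Q ^ e) where

      module _ (i : ℕ) (c : Fin M) (c≡a+i : toℕ c ≡ a + i) where

        private
          e : ℕ
          e = suc (κ (suc i))

          trapped : Subset m → Colouring → ℕ
          trapped Z ℓ = 𝟙 (Z ⊆? canonical i ℓ)

          open IsSum (∑ⱽ-isSum (allFin M) m) using () renaming (sum-*ˡ to ∑ᶜ-*ˡ)
          open IsSum (∑ⱽ-isSum bools m) using () renaming (sum-mono to ∑ˢ-mono; sum-*ˡ to ∑ˢ-*ˡ; sum-*ʳ to ∑ˢ-*ʳ)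
          ∑ˢ-isSum : IsSum (∑ˢ m)
          ∑ˢ-isSum = ∑ⱽ-isSum bools m

        failures≤∑encodes : failures i ≤ ∑ˢ m (λ Z → ∑[ S ∈ 𝒢 ] ∑ᶜ (λ ℓ → encodes i c ℓ S Z))
        failures≤∑encodes = begin
          ∑[ S ∈ 𝒢 ] ∑ᶜ (λ ℓ → failsAt i ℓ S)
            ≤⟨ ∑-mono-∈ 𝒢 (λ S S∈𝒢 → ∑ᶜ-mono (λ ℓ → failsAt≤∑encodes i ℓ S S∈𝒢 c c≡a+i)) ⟩
          ∑[ S ∈ 𝒢 ] ∑ᶜ (λ ℓ → ∑ˢ m (encodes i c ℓ S))
            ≡⟨ ∑-cong 𝒢 (λ S → ∑ⱽ-comm ∑ˢ-isSum (allFin M) m (λ ℓ → encodes i c ℓ S)) ⟩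
          ∑[ S ∈ 𝒢 ] ∑ˢ m (λ Z → ∑ᶜ (λ ℓ → encodes i c ℓ S Z))
            ≡⟨ ∑-comm ∑ˢ-isSum 𝒢 _ ⟩
          ∑ˢ m (λ Z → ∑[ S ∈ 𝒢 ] ∑ᶜ (λ ℓ → encodes i c ℓ S Z)) ∎
          where open ≤-Reasoning

        ∑encodes≤ : ∀ Z → ∑[ S ∈ 𝒢 ] ∑ᶜ (λ ℓ → encodes i c ℓ S Z) ≤
                          degree 𝒢 Z * (𝟙 (e ≤? ∣ Z ∣) * (M ^ ∣ Z ∣ * ∑ᶜ (trapped Z)))
        ∑encodes≤ Z = begin
          ∑[ S ∈ 𝒢 ] ∑ᶜ (λ ℓ → 𝟙 (Z ⊆? S) * (big * trapped Z (recolour Z c ℓ)))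
            ≡⟨ ∑-cong 𝒢 (λ S → ∑ᶜ-*ˡ (𝟙 (Z ⊆? S)) _) ⟩
          ∑[ S ∈ 𝒢 ] (𝟙 (Z ⊆? S) * ∑ᶜ (λ ℓ → big * trapped Z (recolour Z c ℓ)))
            ≡⟨ IsSum.sum-*ʳ (∑-isSum 𝒢) _ (λ S → 𝟙 (Z ⊆? S)) ⟩
          degree 𝒢 Z * ∑ᶜ (λ ℓ → big * trapped Z (recolour Z c ℓ))
            ≡⟨ cong (degree 𝒢 Z *_) (∑ᶜ-*ˡ big _) ⟩
          degree 𝒢 Z * (big * ∑ᶜ (λ ℓ → trapped Z (recolour Z c ℓ)))
            ≤⟨ *-monoʳ-≤ (degree 𝒢 Z) (*-monoʳ-≤ big (∑ᶜ-recolour Z c (trapped Z))) ⟩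
          degree 𝒢 Z * (big * (M ^ ∣ Z ∣ * ∑ᶜ (trapped Z))) ∎
          where
          open ≤-Reasoning
          big : ℕ
          big = 𝟙 (e ≤? ∣ Z ∣)

        spread-subset : ∀ Z X → degree 𝒢 Z * (𝟙 (e ≤? ∣ Z ∣) * (M ^ ∣ Z ∣ * X)) * P ^ e ≤ length 𝒢 * Q ^ e * X
        spread-subset Z X with e ≤? ∣ Z ∣
        ... | no ¬e≤∣Z∣ rewrite dec-false (e ≤? ∣ Z ∣) ¬e≤∣Z∣ =
          ≤-trans (≤-reflexive (cong (_* P ^ e) (*-zeroʳ (degree 𝒢 Z)))) z≤n
        ... | yes e≤∣Z∣ rewrite dec-true (e ≤? ∣ Z ∣) e≤∣Z∣ =
          ≤-trans (≤-reflexive (shuffle (degree 𝒢 Z) (M ^ ∣ Z ∣) X (P ^ e)))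
                                  (*-monoˡ-≤ X (spread e Z (s≤s z≤n) e≤∣Z∣))
          where
          shuffle : ∀ d w x p → d * (1 * (w * x)) * p ≡ d * w * p * x
          shuffle = solve-∀

        ∑trapped≤ : ∑ˢ m (λ Z → ∑ᶜ (trapped Z)) ≤ M ^ m * 2 ^ κ i
        ∑trapped≤ = begin
          ∑ˢ m (λ Z → ∑ᶜ (trapped Z))   ≡⟨ ∑ⱽ-comm ∑ˢ-isSum (allFin M) m (λ ℓ Z → trapped Z ℓ) ⟨
          ∑ᶜ (λ ℓ → ∑ˢ m (λ Z → trapped Z ℓ))
            ≤⟨ ∑ᶜ-mono (λ ℓ → ≤-trans (∑ˢ-subsets (canonical i ℓ)) (^-monoʳ-≤ 2 (∣canonical∣≤κ i ℓ))) ⟩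
          ∑ᶜ (λ _ → 2 ^ κ i)           ≡⟨ ∑ⱽ-const (allFin M) m _ ⟩
          length (allFin M) ^ m * 2 ^ κ i ≡⟨ cong (λ n → n ^ m * 2 ^ κ i) (length-tabulate id) ⟩
          M ^ m * 2 ^ κ i ∎
          where open ≤-Reasoning

        failures-bound : failures i * P ^ e ≤ length 𝒢 * M ^ m * Q ^ e * 2 ^ κ i
        failures-bound = begin
          failures i * P ^ e
            ≤⟨ *-monoˡ-≤ (P ^ e) (≤-trans failures≤∑encodes (∑ˢ-mono ∑encodes≤)) ⟩
          ∑ˢ m (λ Z → degree 𝒢 Z * (𝟙 (e ≤? ∣ Z ∣) * (M ^ ∣ Z ∣ * ∑ᶜ (trapped Z)))) * P ^ e
            ≡⟨ ∑ˢ-*ʳ (P ^ e) _ ⟨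
          ∑ˢ m (λ Z → degree 𝒢 Z * (𝟙 (e ≤? ∣ Z ∣) * (M ^ ∣ Z ∣ * ∑ᶜ (trapped Z))) * P ^ e)
            ≤⟨ ∑ˢ-mono (λ Z → spread-subset Z (∑ᶜ (trapped Z))) ⟩
          ∑ˢ m (λ Z → length 𝒢 * Q ^ e * ∑ᶜ (trapped Z))
            ≡⟨ ∑ˢ-*ˡ (length 𝒢 * Q ^ e) _ ⟩
          length 𝒢 * Q ^ e * ∑ˢ m (λ Z → ∑ᶜ (trapped Z))
            ≤⟨ *-monoʳ-≤ (length 𝒢 * Q ^ e) ∑trapped≤ ⟩
          length 𝒢 * Q ^ e * (M ^ m * 2 ^ κ i)
            ≡⟨ shuffle (length 𝒢) (Q ^ e) (M ^ m) (2 ^ κ i) ⟩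
          length 𝒢 * M ^ m * Q ^ e * 2 ^ κ i ∎
          where
          open ≤-Reasoning
          shuffle : ∀ n q w t → n * q * (w * t) ≡ n * w * q * t
          shuffle = solve-∀

    module Window (P Q : ℕ) (16Q<P : 16 * Q < P)
      (spread : ∀ e Z → 0 < e → e ≤ ∣ Z ∣ → degree 𝒢 Z * M ^ ∣ Z ∣ * P ^ e ≤ length 𝒢 * Q ^ e)
      (L : ℕ) (halving : HalvingTime k L) (a+L≤M : a + L ≤ M) where

      open Counting P Q spread

      misses : Colouring → ℕ
      misses ℓ = ∑[ S ∈ 𝒢 ] failed L ℓ S

      private
        instance
          P≢0 : NonZero P
          P≢0 = >-nonZero (≤-trans (s≤s z≤n) 16Q<P)

        weight : ℕ → ℕ
        weight i = 4 * 2 ^ κ i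

        weighted-failures : ∀ i → i < L → failures i * weight i ≤ length 𝒢 * M ^ m
        weighted-failures i i<L =
          weighted-round {failures i} {P = P} {Q} (κ i) (<⇒≤ 16Q<P) (failures-bound i c (toℕ-fromℕ< a+i<M))
          where
          a+i<M : a + i < M
          a+i<M = ≤-trans (+-monoʳ-< a i<L) a+L≤M
          c : Fin M
          c = fromℕ< a+i<M

        weight-halves : ∀ i → i < L → 2 * weight (suc i) ≤ weight i
        weight-halves i i<L = begin
          2 * (4 * 2 ^ κ (suc i)) ≡⟨ *-comm-middle 2 4 (2 ^ κ (suc i)) ⟩
          4 * 2 ^ suc (κ (suc i)) ≤⟨ *-monoʳ-≤ 4 (^-monoʳ-≤ 2 (⌊n/2⌋<n′ (proj₁ (proj₂ halving) i i<L))) ⟩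
          4 * 2 ^ κ i             ∎
          where
          open ≤-Reasoning
          *-comm-middle : ∀ x y z → x * (y * z) ≡ y * (x * z)
          *-comm-middle = solve-∀
          ⌊n/2⌋<n′ : ∀ {n} → 0 < n → ⌊ n /2⌋ < n
          ⌊n/2⌋<n′ {suc n} _ = ⌊n/2⌋<n n

      ∑misses-bound : ∑ᶜ misses * 4 ≤ length 𝒢 * M ^ m
      ∑misses-bound = begin
        ∑ᶜ misses * 4
          ≡⟨ cong (_* 4) (∑ⱽ-comm (∑-isSum 𝒢) (allFin M) m (λ ℓ S → failed L ℓ S)) ⟩
        ∑[ S ∈ 𝒢 ] ∑ᶜ (λ ℓ → failed L ℓ S) * 4
          ≤⟨ *-monoˡ-≤ 4 (∑-mono-∈ 𝒢 (λ S _ → ∑ᶜ-mono (λ ℓ → failed≤∑failsAt L ℓ S))) ⟩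
        ∑[ S ∈ 𝒢 ] ∑ᶜ (λ ℓ → ∑[ i ∈ downFrom L ] failsAt i ℓ S) * 4
          ≡⟨ cong (_* 4) (trans (∑-cong 𝒢 (λ S → ∑ⱽ-comm (∑-isSum (downFrom L)) (allFin M) m (λ ℓ i → failsAt i ℓ S)))
                                (∑-comm (∑-isSum (downFrom L)) 𝒢 _)) ⟩
        ∑[ i ∈ downFrom L ] failures i * 4
          ≡⟨ cong (λ κ → ∑[ i ∈ downFrom L ] failures i * (4 * 2 ^ κ)) (proj₁ halving) ⟨
        ∑[ i ∈ downFrom L ] failures i * weight L
          ≤⟨ ∑-geometric failures weight _ L weighted-failures weight-halves ⟩
        length 𝒢 * M ^ m ∎
        where open ≤-Reasoning

      misses<∣𝒢∣⇒⊆window : ∀ ℓ → misses ℓ < length 𝒢 → Σ (Subset m) λ T → T ∈ₗ 𝒢 × T ⊆ window a (a + L) ℓ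
      misses<∣𝒢∣⇒⊆window ℓ misses<
        with ∑<∑⇒∃ 𝒢 (failed L ℓ) (λ _ → 1) (subst (misses ℓ <_) ∣𝒢∣≡∑1 misses<)
        where
        ∣𝒢∣≡∑1 : length 𝒢 ≡ ∑[ S ∈ 𝒢 ] 1
        ∣𝒢∣≡∑1 = trans (sym (*-identityʳ _)) (sym (∑-const 𝒢 1))
      ... | S , S∈𝒢 , failed<1 with run L ℓ S in ran
      ...   | nothing = ⊥-elim (<-irrefl refl failed<1)
      ...   | just T  with run-invariant L ℓ S S∈𝒢 ran
      ...     | T∈𝒢 , ∣T─W∣≤κL , _ = T , T∈𝒢 , ∣p─q∣≤0⇒p⊆q (subst (∣ T ─ W L ℓ ∣ ≤_) (proj₁ halving) ∣T─W∣≤κL)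

module SpreadBounds where

  open FiniteSums
  open Halving
  open Subsets
  open HalvingProcess
  open Fractions
  open import Data.Nat using (ℕ; zero; suc; _+_; _*_; _^_; _∸_; _≤_; _<_; z≤n; s≤s; NonZero; >-nonZero; _<?_)
  open import Data.Nat.Properties
  open import Data.Nat.Tactic.RingSolver using (solve-∀)
  open import Data.Integer using (+_)
  open import Data.Rational using (ℚ; ↥_; ↧ₙ_)
  open import Data.Fin using (Fin; zero)
  open import Data.Vec using (Vec)
  open import Data.Vec.Base using (here)
  open import Data.Fin.Subset using (∣_∣; Nonempty; ⊤)
  open import Data.Fin.Subset.Properties using (_⊆?_)
  open import Data.List using ([]; _∷_; length; filter; allFin)
  open import Data.List.Properties using (length-map; length-tabulate)
  open import Data.Product using (_×_; _,_; ∃)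
  open import Data.Empty using (⊥-elim)
  open import Function using (id)
  open import Data.Bool using (true; false)
  open import Relation.Binary.PropositionalEquality
  open import Relation.Nullary using (yes; no; does)

  length-link : ∀ {m} (𝒢 : Family m) Z → length (link 𝒢 Z) ≡ degree 𝒢 Z
  length-link 𝒢 Z = trans (length-map _ (filter (Z ⊆?_) 𝒢)) (length-filter 𝒢)
    where
    length-filter : ∀ 𝒢 → length (filter (Z ⊆?_) 𝒢) ≡ degree 𝒢 Z
    length-filter []      = refl
    length-filter (S ∷ 𝒢) with does (Z ⊆? S)
    ... | true  = cong suc (length-filter 𝒢)
    ... | false = length-filter 𝒢

  -- Each of the d points beyond the first e pays for its factor M with a factor q / p ≤ 1 / M.
  trade-powers : ∀ {c N M p q} e d → .{{_ : NonZero p}} → M * q ≤ p →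
                 c * p ^ (e + d) < N * q ^ (e + d) → c * M ^ (e + d) * p ^ e ≤ N * (M * q) ^ e
  trade-powers {c} {N} {M} {p} {q} e d Mq≤p c<N = *-cancelʳ-≤ _ _ (p ^ d) {{m^n≢0 p d}} (begin
    c * M ^ t * p ^ e * p ^ d       ≡⟨ shuffle₁ c (M ^ t) (p ^ e) (p ^ d) ⟩
    c * (p ^ e * p ^ d) * M ^ t     ≡⟨ cong (λ x → c * x * M ^ t) (^-distribˡ-+-* p e d) ⟨
    c * p ^ t * M ^ t               ≤⟨ *-monoˡ-≤ (M ^ t) (<⇒≤ c<N) ⟩
    N * q ^ t * M ^ t               ≡⟨ shuffle₂ N (q ^ t) (M ^ t) ⟩
    N * (M ^ t * q ^ t)             ≡⟨ cong (N *_) (^-distribʳ-* M q t) ⟨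
    N * (M * q) ^ t                 ≡⟨ cong (N *_) (^-distribˡ-+-* (M * q) e d) ⟩
    N * ((M * q) ^ e * (M * q) ^ d) ≤⟨ *-monoʳ-≤ N (*-monoʳ-≤ ((M * q) ^ e) (^-monoˡ-≤ d Mq≤p)) ⟩
    N * ((M * q) ^ e * p ^ d)       ≡⟨ *-assoc N _ _ ⟨
    N * (M * q) ^ e * p ^ d         ∎)
    where
    open ≤-Reasoning
    t : ℕ
    t = e + d
    shuffle₁ : ∀ a b x y → a * b * x * y ≡ a * (x * y) * b
    shuffle₁ = solve-∀
    shuffle₂ : ∀ a b x → a * b * x ≡ a * (x * b)
    shuffle₂ = solve-∀

  module _ {m} {R : ℚ} {p : ℕ} (↥R≡p : ↥ R ≡ + p) (𝒢 : Family m) (spread : Spread R 𝒢) where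

    spread⇒degree< : ∀ Z → Nonempty Z → degree 𝒢 Z * p ^ ∣ Z ∣ < length 𝒢 * ↧ₙ R ^ ∣ Z ∣
    spread⇒degree< Z ne =
      subst (λ d → d * p ^ ∣ Z ∣ < length 𝒢 * ↧ₙ R ^ ∣ Z ∣) (length-link 𝒢 Z)
            (ℚ-spread⇒ℕ R ↥R≡p (length (link 𝒢 Z)) (length 𝒢) ∣ Z ∣ (spread Z ne))

    spread⇒nonempty : 0 < m → 0 < length 𝒢
    spread⇒nonempty 0<m with length 𝒢 | spread⇒degree< ⊤ (nonempty-⊤ 0<m)
      where
      nonempty-⊤ : 0 < m → Nonempty (⊤ {m})
      nonempty-⊤ (s≤s _) = zero , here
    ... | zero  | ()
    ... | suc _ | _ = s≤s z≤n

    spread⇒coloured-degree : ∀ M → M * ↧ₙ R ≤ p → .{{_ : NonZero p}} → ∀ e Z → 0 < e → e ≤ ∣ Z ∣ →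
                             degree 𝒢 Z * M ^ ∣ Z ∣ * p ^ e ≤ length 𝒢 * (M * ↧ₙ R) ^ e
    spread⇒coloured-degree M Mq≤p e Z 0<e e≤∣Z∣ =
      subst (λ t → degree 𝒢 Z * M ^ t * p ^ e ≤ length 𝒢 * (M * ↧ₙ R) ^ e) t≡∣Z∣
        (trade-powers {degree 𝒢 Z} {length 𝒢} {M} {p} {↧ₙ R} e (∣ Z ∣ ∸ e) Mq≤p
          (subst (λ t → degree 𝒢 Z * p ^ t < length 𝒢 * ↧ₙ R ^ t) (sym t≡∣Z∣)
            (spread⇒degree< Z (0<∣p∣⇒Nonempty Z (≤-trans 0<e e≤∣Z∣)))))
      where
      t≡∣Z∣ : e + (∣ Z ∣ ∸ e) ≡ ∣ Z ∣
      t≡∣Z∣ = m+[n∸m]≡n e≤∣Z∣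

  log-bound⇒16[L+L]q<p : ∀ {k L q p} → 2 ^ L ≤ 2 * k → (2 * k) ^ (32 * q) < 2 ^ p → 16 * ((L + L) * q) < p
  log-bound⇒16[L+L]q<p {k} {L} {q} {p} 2^L≤2k bound with 16 * ((L + L) * q) <? p
  ... | yes lt = lt
  ... | no ≮p = ⊥-elim (<⇒≱ bound (begin
    2 ^ p                    ≤⟨ ^-monoʳ-≤ 2 (≮⇒≥ ≮p) ⟩
    2 ^ (16 * ((L + L) * q)) ≡⟨ cong (2 ^_) (shuffle L q) ⟩
    2 ^ (L * (32 * q))       ≡⟨ ^-*-assoc 2 L (32 * q) ⟨
    (2 ^ L) ^ (32 * q)       ≤⟨ ^-monoˡ-≤ (32 * q) 2^L≤2k ⟩
    (2 * k) ^ (32 * q)       ∎))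
    where
    open ≤-Reasoning
    shuffle : ∀ L q → 16 * ((L + L) * q) ≡ L * (32 * q)
    shuffle = solve-∀

  -- N₂ f + N₁ g averages at most N₁ N₂ / 2 < N₁ N₂.
  both-below-quarter : ∀ {M m} (f g : Vec (Fin M) m → ℕ) {N₁ N₂} → 0 < M ^ m * (N₁ * N₂) →
                       ∑ⱽ (allFin M) m f * 4 ≤ N₁ * M ^ m → ∑ⱽ (allFin M) m g * 4 ≤ N₂ * M ^ m →
                       ∃ λ ℓ → f ℓ < N₁ × g ℓ < N₂
  both-below-quarter {M} {m} f g {N₁} {N₂} 0<C f-small g-small with ∑ⱽ<∑ⱽ⇒∃ (allFin M) m h (λ _ → N₁ * N₂) ∑h<
    where
    C : ℕ
    C = M ^ m
    h : Vec (Fin M) m → ℕ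
    h ℓ = N₂ * f ℓ + N₁ * g ℓ
    open IsSum (∑ⱽ-isSum (allFin M) m)
    ∑h< : ∑ⱽ (allFin M) m h < ∑ⱽ (allFin M) m (λ _ → N₁ * N₂)
    ∑h< = *-cancelʳ-< 4 _ _ (begin-strict
      ∑ⱽ (allFin M) m h * 4
        ≡⟨ cong (_* 4) (trans (sum-+ _ _) (cong₂ _+_ (sum-*ˡ N₂ f) (sum-*ˡ N₁ g))) ⟩
      (N₂ * ∑ⱽ (allFin M) m f + N₁ * ∑ⱽ (allFin M) m g) * 4
        ≡⟨ shuffle₁ N₂ N₁ (∑ⱽ (allFin M) m f) (∑ⱽ (allFin M) m g) ⟩
      N₂ * (∑ⱽ (allFin M) m f * 4) + N₁ * (∑ⱽ (allFin M) m g * 4)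
        ≤⟨ +-mono-≤ (*-monoʳ-≤ N₂ f-small) (*-monoʳ-≤ N₁ g-small) ⟩
      N₂ * (N₁ * C) + N₁ * (N₂ * C)
        ≡⟨ shuffle₂ N₁ N₂ C ⟩
      C * (N₁ * N₂) * 2
        <⟨ *-monoʳ-< (C * (N₁ * N₂)) {{>-nonZero 0<C}} (s≤s (s≤s (s≤s z≤n))) ⟩
      C * (N₁ * N₂) * 4
        ≡⟨ cong (λ n → n ^ m * (N₁ * N₂) * 4) (length-tabulate id) ⟨
      length (allFin M) ^ m * (N₁ * N₂) * 4
        ≡⟨ cong (_* 4) (∑ⱽ-const (allFin M) m (N₁ * N₂)) ⟨
      ∑ⱽ (allFin M) m (λ _ → N₁ * N₂) * 4 ∎)
      where
      open ≤-Reasoning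
      shuffle₁ : ∀ a b x y → (a * x + b * y) * 4 ≡ a * (x * 4) + b * (y * 4)
      shuffle₁ = solve-∀
      shuffle₂ : ∀ a b c → b * (a * c) + a * (b * c) ≡ c * (a * b) * 2
      shuffle₂ = solve-∀
  ... | ℓ , h<N₁N₂ =
    ℓ , *-cancelˡ-< N₂ _ _ (≤-<-trans (m≤m+n _ _) (subst (N₂ * f ℓ + N₁ * g ℓ <_) (*-comm N₁ N₂) h<N₁N₂))
      , *-cancelˡ-< N₁ _ _ (≤-<-trans (m≤n+m _ _) h<N₁N₂)

open import Data.Nat using (ℕ; _<_; _*_; _+_; _^_; _≤_; NonZero; >-nonZero; z≤n; s≤s)
open import Data.Nat.Properties
open import Data.Rational using (ℚ; ↧ₙ_)
open import Data.Fin.Subset using (Subset; _∩_; Empty; ∣_∣)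
open import Data.List using (length)
open import Data.List.Membership.Propositional using (_∈_)
open import Data.List.Relation.Unary.Unique.Propositional using (Unique)
open import Data.Product using (Σ; _×_; _,_; proj₁; proj₂)
open import Relation.Binary.PropositionalEquality

open Halving
open Colourings
open HalvingProcess
open SpreadBounds

UniformAtMost⇒small : ∀ {m k} {𝒢 : Family m} → UniformAtMost k 𝒢 → ∀ S → S ∈ 𝒢 → ∣ S ∣ ≤ k
UniformAtMost⇒small {k = k} (s , s≤k , ∣S∣≡s) S S∈𝒢 = subst (_≤ k) (sym (∣S∣≡s S S∈𝒢)) s≤k

lemma6 : (m k : ℕ) → 0 < m → 0 < k → (R : ℚ) → AboveLogBound R k →
    (𝒢₁ 𝒢₂ : Family m) → Unique 𝒢₁ → Unique 𝒢₂ →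
    Spread R 𝒢₁ → Spread R 𝒢₂ → UniformAtMost k 𝒢₁ → UniformAtMost k 𝒢₂ →
    Σ (Subset m) λ G₁ → Σ (Subset m) λ G₂ → (G₁ ∈ 𝒢₁) × (G₂ ∈ 𝒢₂) × Empty (G₁ ∩ G₂)
lemma6 m k 0<m 0<k R (p , ↥R≡p , log-bound) 𝒢₁ 𝒢₂ _ _ spread₁ spread₂ uniform₁ uniform₂ =
  let ℓ , few₁ , few₂ =
        both-below-quarter W₁.misses W₂.misses 0<M^m∣𝒢₁∣∣𝒢₂∣ W₁.∑misses-bound W₂.∑misses-bound
      T₁ , T₁∈𝒢₁ , T₁⊆W₁ = W₁.misses<∣𝒢∣⇒⊆window ℓ few₁
      T₂ , T₂∈𝒢₂ , T₂⊆W₂ = W₂.misses<∣𝒢∣⇒⊆window ℓ few₂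
  in T₁ , T₂ , T₁∈𝒢₁ , T₂∈𝒢₂ , ⊆-windows-disjoint 0 L M ℓ T₁⊆W₁ T₂⊆W₂
  where
  L : ℕ
  L = proj₁ (halvingTime k 0<k)
  halving : HalvingTime k L
  halving = proj₂ (halvingTime k 0<k)
  M : ℕ
  M = L + L
  16Mq<p : 16 * (M * ↧ₙ R) < p
  16Mq<p = log-bound⇒16[L+L]q<p {k} {L} {↧ₙ R} {p} (proj₂ (proj₂ halving)) log-bound
  p≢0 : NonZero p
  p≢0 = >-nonZero (≤-trans (s≤s z≤n) 16Mq<p)
  Mq≤p : M * ↧ₙ R ≤ p
  Mq≤p = ≤-trans (m≤n*m (M * ↧ₙ R) 16) (<⇒≤ 16Mq<p)
  module W₁ = Process.Window M 𝒢₁ k 0 (UniformAtMost⇒small uniform₁) p (M * ↧ₙ R) 16Mq<p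
                (spread⇒coloured-degree ↥R≡p 𝒢₁ spread₁ M Mq≤p {{p≢0}}) L halving (m≤m+n L L)
  module W₂ = Process.Window M 𝒢₂ k L (UniformAtMost⇒small uniform₂) p (M * ↧ₙ R) 16Mq<p
                (spread⇒coloured-degree ↥R≡p 𝒢₂ spread₂ M Mq≤p {{p≢0}}) L halving ≤-refl
  0<M^m∣𝒢₁∣∣𝒢₂∣ : 0 < M ^ m * (length 𝒢₁ * length 𝒢₂)
  0<M^m∣𝒢₁∣∣𝒢₂∣ = *-mono-< (m^n>0 M {{>-nonZero (+-mono-< 0<L 0<L)}} m)
                          (*-mono-< (spread⇒nonempty ↥R≡p 𝒢₁ spread₁ 0<m) (spread⇒nonempty ↥R≡p 𝒢₂ spread₂ 0<m))
    where
    0<L : 0 < L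
    0<L = HalvingTime⇒0<L 0<k halving
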